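{- Let $\mathfrak{F}=(X,R)$ be a rooted frame, $\mathfrak{G}=(Y,S)$ a rooted image-finite frame, $y\in Y$ and $k\in\mathbb{Z}^+$. Suppose $X=R_\sharp^{k-1}[x]$ for all $x\in X$. Then there is a surjective t-morphism from $\mathfrak{F}$ onto $\mathfrak{G}$ if and only if $\mathfrak{F}\not\models\neg\mathcal{J}^k(\mathfrak{G},y)$.
   Context: Tense formulas use $\Box$, $\Diamond=\neg\Box\neg$ and a past possibility operator written here $\mathsf{P}$ ($\mathsf{P}\phi$ true at $x$ iff $\phi$ true at some $z$ with $Rzx$). Frames here are arbitrary Kripke frames. For a frame $(X,R)$ and $x\in X$: $R_\sharp^0[x]=\{x\}$, $R_\sharp^{j+1}[x]=R_\sharp^j[x]\cup R[R_\sharp^j[x]]\cup R^{ -1}[R_\sharp^j[x]]$; the frame is rooted if $X=\bigcup_jR_\sharp^j[x]$ for some $x$, and image-finite if $R_\sharp^1[x]$ is finite for every $x$. Let $\Delta^0\phi=\phi$, $\Delta^{j+1}\phi=\Delta^j\phi\vee\Diamond\Delta^j\phi\vee\mathsf{P}\Delta^j\phi$ and $\nabla^j\phi=\neg\Delta^j\neg\phi$. For an image-finite $\mathfrak{G}=(Y,S)$, $y\in Y$ and $k\in\mathbb{Z}^+$, enumerate $S_\sharp^k[y]$ as $\langle y_i:i<n\rangle$ with $y_0=y$; the generalized Jankov formula $\mathcal{J}^k(\mathfrak{G},y)$ is the conjunction of: $p_0\wedge\nabla^k(p_0\vee\dots\vee p_{n-1})$; $\nabla^k(p_i\to\neg p_j)$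 for $i\neq j$; $\nabla^{k-1}((p_i\to\Diamond p_j)\wedge(p_j\to\mathsf{P}p_i))$ whenever $Sy_iy_j$; $\nabla^{k-1}((p_i\to\neg\Diamond p_j)\wedge(p_j\to\neg\mathsf{P}p_i))$ whenever not $Sy_iy_j$. A t-morphism $f:(X,R)\to(Y,S)$ is a map with $f[R[x]]=S[f(x)]$ and $f[R^{ -1}[x]]=S^{ -1}[f(x)]$ for all $x$. -}

module Defs where

open import Data.Nat using (ℕ; zero; suc; _∸_)
open import Data.Fin using (Fin; zero; suc; toℕ; _≟_)
open import Data.List using (List; []; _∷_; map; concatMap; allFin; foldr)
open import Data.Product using (Σ; ∃; _×_; _,_)
open import Data.Sum using (_⊎_)
open import Data.Empty using (⊥)
open import Data.List.Membership.Propositional using (_∈_)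
open import Relation.Nullary using (¬_; Dec; yes; no)
open import Relation.Binary.PropositionalEquality using (_≡_)
open import Function using (_∘_)

record Frame : Set₁ where
  field
    Carrier : Set
    Rel     : Carrier → Carrier → Set
open Frame public

-- R_♯^j[x] as a predicate: Reach F j x z  ⟺  z ∈ R_♯^j[x]
Reach : (F : Frame) → ℕ → Carrier F → Carrier F → Set
Reach F zero    x z = x ≡ z
Reach F (suc j) x z =
  Reach F j x z
  ⊎ (∃ λ w → Reach F j x w × Rel F w z)
  ⊎ (∃ λ w → Reach F j x w × Rel F z w)

Rooted : Frame → Set
Rooted F = ∃ λ x → ∀ z → ∃ λ j → Reach F j x z

FinitePred : {A : Set} → (A → Set) → Set
FinitePred {A} P = ∃ λ (xs : List A) → ∀ z → P z → z ∈ xs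

ImageFinite : Frame → Set
ImageFinite F = ∀ x → FinitePred (Reach F 1 x)

IsTMorphism : (F G : Frame) → (Carrier F → Carrier G) → Set
IsTMorphism F G f =
    (∀ x z → Rel F x z → Rel G (f x) (f z))
  × (∀ x w → Rel G (f x) w → ∃ λ z → Rel F x z × f z ≡ w)
  × (∀ x z → Rel F z x → Rel G (f z) (f x))
  × (∀ x w → Rel G w (f x) → ∃ λ z → Rel F z x × f z ≡ w)

Surjective : {A B : Set} → (A → B) → Set
Surjective {A} {B} f = ∀ (b : B) → ∃ λ (a : A) → f a ≡ b

SurjTMorphismExists : Frame → Frame → Set
SurjTMorphismExists F G =
  ∃ λ (f : Carrier F → Carrier G) → IsTMorphism F G f × Surjective f

data Fm : Set where
  var  : ℕ → Fm
  ⊥'   : Fm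
  _⇒_  : Fm → Fm → Fm
  _∧'_ : Fm → Fm → Fm
  _∨'_ : Fm → Fm → Fm
  □    : Fm → Fm
  𝖯    : Fm → Fm

infixr 4 _⇒_
infixr 6 _∧'_
infixr 5 _∨'_

¬' : Fm → Fm
¬' φ = φ ⇒ ⊥'

⊤' : Fm
⊤' = ¬' ⊥'

◇ : Fm → Fm
◇ φ = ¬' (□ (¬' φ))

Valuation : Frame → Set₁
Valuation F = ℕ → Carrier F → Set

Sat : (F : Frame) → Valuation F → Carrier F → Fm → Set
Sat F V x (var n)  = V n x
Sat F V x ⊥'       = ⊥
Sat F V x (φ ⇒ ψ)  = Sat F V x φ → Sat F V x ψ
Sat F V x (φ ∧' ψ) = Sat F V x φ × Sat F V x ψ
Sat F V x (φ ∨' ψ) = Sat F V x φ ⊎ Sat F V x ψ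
Sat F V x (□ φ)    = ∀ z → Rel F x z → Sat F V z φ
Sat F V x (𝖯 φ)    = ∃ λ z → Rel F z x × Sat F V z φ

Valid : Frame → Fm → Set₁
Valid F φ = ∀ (V : Valuation F) (x : Carrier F) → Sat F V x φ

Δ : ℕ → Fm → Fm
Δ zero    φ = φ
Δ (suc j) φ = (Δ j φ ∨' ◇ (Δ j φ)) ∨' 𝖯 (Δ j φ)

∇ : ℕ → Fm → Fm
∇ j φ = ¬' (Δ j (¬' φ))

-- Generalized Jankov formula J^k(G, y), relative to an enumeration
-- e : Fin (suc n) → Y of S_♯^k[y] with e zero = y (p_i = var (toℕ i)),
-- and a decision procedure for S (used only to select which conjunct).

⋀ : List Fm → Fm
⋀ = foldr _∧'_ ⊤'

⋁ : (n : ℕ) → (Fin (suc n) → Fm) → Fm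
⋁ zero    f = f zero
⋁ (suc n) f = f zero ∨' ⋁ n (f ∘ suc)

pairs : (m : ℕ) → (Fin m → Fin m → List Fm) → List Fm
pairs m g = concatMap (λ i → concatMap (λ j → g i j) (allFin m)) (allFin m)

Jankov : (G : Frame) → (∀ a b → Dec (Rel G a b)) →
         (n : ℕ) → (Fin (suc n) → Carrier G) → (k : ℕ) → Fm
Jankov G dec n e k =
  (p zero ∧' ∇ k (⋁ n p))
  ∧' ⋀ (pairs (suc n) distinct)
  ∧' ⋀ (pairs (suc n) relational)
  where
    p : Fin (suc n) → Fm
    p i = var (toℕ i)
    distinct : Fin (suc n) → Fin (suc n) → List Fm
    distinct i j with i ≟ j
    ... | yes _ = []
    ... | no  _ = ∇ k (p i ⇒ ¬' (p j)) ∷ []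
    relational : Fin (suc n) → Fin (suc n) → List Fm
    relational i j with dec (e i) (e j)
    ... | yes _ = ∇ (k ∸ 1) ((p i ⇒ ◇ (p j)) ∧' (p j ⇒ 𝖯 (p i))) ∷ []
    ... | no  _ = ∇ (k ∸ 1) ((p i ⇒ ¬' (◇ (p j))) ∧' (p j ⇒ ¬' (𝖯 (p i)))) ∷ []

-- If V, x satisfy J^k(G, y), every point of F lies within k − 1 steps of x, so every ∇-conjunct
-- holds everywhere: each point z satisfies exactly one p_i, and z ↦ e i is a t-morphism by the
-- relational conjuncts. Its image contains y and is closed under S and S⁻¹, hence is all of the
-- rooted frame G. Conversely, a surjective t-morphism f pulls the valuation "p_i holds at e i"
-- back to F, where J^k(G, y) then holds at any preimage of y.
module Submission where

open import Defs
open import Axiom.DoubleNegationElimination using (em⇒dne)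
open import Axiom.ExcludedMiddle using (ExcludedMiddle)
open import Data.Empty using (⊥-elim)
open import Data.Fin using (Fin; zero; suc; toℕ; _≟_)
open import Data.Fin.Properties using (toℕ-injective)
open import Data.List using (List; []; _∷_; _++_; concat; concatMap; map; tabulate; allFin)
open import Data.List.Relation.Unary.All using (All; []; _∷_)
open import Data.List.Relation.Unary.All.Properties
  using (++⁺; ++⁻; concat⁺; concat⁻; map⁺; map⁻; tabulate⁺; tabulate⁻)
open import Data.Nat using (ℕ; zero; suc; _≤_; _∸_; s≤s; z≤n)
open import Data.Product using (∃; ∃₂; _×_; _,_; proj₁; proj₂)
open import Data.Sum using (_⊎_; inj₁; inj₂)
open import Function using (_∘_; id)
open import Function.Bundles using (_⇔_; mk⇔)
open import Function.Definitions using (Injective)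
open import Level using (0ℓ)
open import Relation.Nullary using (¬_; Dec; yes; no; contradiction)
open import Relation.Binary.PropositionalEquality
  using (_≡_; _≢_; refl; sym; trans; cong; subst; subst₂)

Adjacent : (F : Frame) → Carrier F → Carrier F → Set
Adjacent F a b = Rel F a b ⊎ Rel F b a

module _ {F : Frame} where

  Reach-stepˡ : ∀ j {x w z} → Adjacent F x w → Reach F j w z → Reach F (suc j) x z
  Reach-stepˡ zero    (inj₁ xRw) refl = inj₂ (inj₁ (_ , refl , xRw))
  Reach-stepˡ zero    (inj₂ wRx) refl = inj₂ (inj₂ (_ , refl , wRx))
  Reach-stepˡ (suc j) a (inj₁ q)                     = inj₁ (Reach-stepˡ j a q)
  Reach-stepˡ (suc j) a (inj₂ (inj₁ (v , q , vRz))) =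
    inj₂ (inj₁ (v , Reach-stepˡ j a q , vRz))
  Reach-stepˡ (suc j) a (inj₂ (inj₂ (v , q , zRv))) =
    inj₂ (inj₂ (v , Reach-stepˡ j a q , zRv))

  Reach-firstStep : ∀ j {x z} → Reach F (suc j) x z →
                    Reach F j x z ⊎ ∃ λ w → Adjacent F x w × Reach F j w z
  Reach-firstStep zero    (inj₁ x≡z)                     = inj₁ x≡z
  Reach-firstStep zero    (inj₂ (inj₁ (_ , refl , xRz))) = inj₂ (_ , inj₁ xRz , refl)
  Reach-firstStep zero    (inj₂ (inj₂ (_ , refl , zRx))) = inj₂ (_ , inj₂ zRx , refl)
  Reach-firstStep (suc j) (inj₁ q)                       = inj₁ q
  Reach-firstStep (suc j) (inj₂ (inj₁ (v , q , vRz))) with Reach-firstStep j q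
  ... | inj₁ q′            = inj₁ (inj₂ (inj₁ (v , q′ , vRz)))
  ... | inj₂ (w , a , q′) = inj₂ (w , a , inj₂ (inj₁ (v , q′ , vRz)))
  Reach-firstStep (suc j) (inj₂ (inj₂ (v , q , zRv))) with Reach-firstStep j q
  ... | inj₁ q′            = inj₁ (inj₂ (inj₂ (v , q′ , zRv)))
  ... | inj₂ (w , a , q′) = inj₂ (w , a , inj₂ (inj₂ (v , q′ , zRv)))

  Reach-sym : ∀ j {x z} → Reach F j x z → Reach F j z x
  Reach-sym zero    refl                         = refl
  Reach-sym (suc j) (inj₁ q)                     = inj₁ (Reach-sym j q)
  Reach-sym (suc j) (inj₂ (inj₁ (w , q , wRz))) = Reach-stepˡ j (inj₂ wRz) (Reach-sym j q)
  Reach-sym (suc j) (inj₂ (inj₂ (w , q , zRw))) = Reach-stepˡ j (inj₁ zRw) (Reach-sym j q)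

  module _ {P : Carrier F → Set} (closed : ∀ {a b} → Adjacent F a b → P a → P b) where

    Reach-closed : ∀ j {x z} → Reach F j x z → P x → P z
    Reach-closed zero    refl                         px = px
    Reach-closed (suc j) (inj₁ q)                     px = Reach-closed j q px
    Reach-closed (suc j) (inj₂ (inj₁ (w , q , wRz))) px =
      closed (inj₁ wRz) (Reach-closed j q px)
    Reach-closed (suc j) (inj₂ (inj₂ (w , q , zRw))) px =
      closed (inj₂ zRw) (Reach-closed j q px)

    Rooted-closed : Rooted F → ∀ {y} → P y → ∀ z → P z
    Rooted-closed (r , reach) {y} py z with reach y | reach z
    ... | i , r⇝y | j , r⇝z = Reach-closed j r⇝z (Reach-closed i (Reach-sym i r⇝y) py)

Reach-map : ∀ {F G} (f : Carrier F → Carrier G) →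
            (∀ {a b} → Rel F a b → Rel G (f a) (f b)) →
            ∀ j {x z} → Reach F j x z → Reach G j (f x) (f z)
Reach-map f forth zero    refl     = refl
Reach-map f forth (suc j) (inj₁ q) = inj₁ (Reach-map f forth j q)
Reach-map f forth (suc j) (inj₂ (inj₁ (w , q , wRz))) =
  inj₂ (inj₁ (f w , Reach-map f forth j q , forth wRz))
Reach-map f forth (suc j) (inj₂ (inj₂ (w , q , zRw))) =
  inj₂ (inj₂ (f w , Reach-map f forth j q , forth zRw))

module _ {F : Frame} {V : Valuation F} where

  Sat-Δ⁺ : ∀ j {φ x z} → Reach F j x z → Sat F V z φ → Sat F V x (Δ j φ)
  Sat-Δ⁺ zero    refl s = s
  Sat-Δ⁺ (suc j) q    s with Reach-firstStep j q
  ... | inj₁ q′                   = inj₁ (inj₁ (Sat-Δ⁺ j q′ s))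
  ... | inj₂ (w , inj₁ xRw , q′) = inj₁ (inj₂ (λ □¬ → □¬ w xRw (Sat-Δ⁺ j q′ s)))
  ... | inj₂ (w , inj₂ wRx , q′) = inj₂ (w , wRx , Sat-Δ⁺ j q′ s)

  Sat-Δ⁻ : ∀ j {φ x} → Sat F V x (Δ j φ) → ¬ (∀ z → Reach F j x z → ¬ Sat F V z φ)
  Sat-Δ⁻ zero    s                    none = none _ refl s
  Sat-Δ⁻ (suc j) (inj₁ (inj₁ s))      none = Sat-Δ⁻ j s (λ z q → none z (inj₁ q))
  Sat-Δ⁻ (suc j) (inj₁ (inj₂ ◇s))     none =
    ◇s (λ w xRw s → Sat-Δ⁻ j s (λ z q → none z (Reach-stepˡ j (inj₁ xRw) q)))
  Sat-Δ⁻ (suc j) (inj₂ (w , wRx , s)) none =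
    Sat-Δ⁻ j s (λ z q → none z (Reach-stepˡ j (inj₂ wRx) q))

  Sat-∇⁺ : ∀ j {φ x} → (∀ z → Reach F j x z → Sat F V z φ) → Sat F V x (∇ j φ)
  Sat-∇⁺ j all Δ¬ = Sat-Δ⁻ j Δ¬ (λ z q ¬s → ¬s (all z q))

  Sat-∇⁻ : ∀ j {φ x z} → Sat F V x (∇ j φ) → Reach F j x z → ¬ ¬ Sat F V z φ
  Sat-∇⁻ j s q ¬s = s (Sat-Δ⁺ j q ¬s)

  Sat-∇-pred : ∀ j {φ x} → Sat F V x (∇ (suc j) φ) → Sat F V x (∇ j φ)
  Sat-∇-pred j s Δ¬ = s (inj₁ (inj₁ Δ¬))

  Sat-⋁⁺ : ∀ n {φ : Fin (suc n) → Fm} {x} i → Sat F V x (φ i) → Sat F V x (⋁ n φ)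
  Sat-⋁⁺ zero    zero    s = s
  Sat-⋁⁺ (suc n) zero    s = inj₁ s
  Sat-⋁⁺ (suc n) (suc i) s = inj₂ (Sat-⋁⁺ n i s)

  Sat-⋁⁻ : ∀ n {φ : Fin (suc n) → Fm} {x} → Sat F V x (⋁ n φ) →
           ∃ λ i → Sat F V x (φ i)
  Sat-⋁⁻ zero    s        = zero , s
  Sat-⋁⁻ (suc n) (inj₁ s) = zero , s
  Sat-⋁⁻ (suc n) (inj₂ s) with Sat-⋁⁻ n s
  ... | i , s′ = suc i , s′

  Sat-⋀⁺ : ∀ {φs x} → All (Sat F V x) φs → Sat F V x (⋀ φs)
  Sat-⋀⁺ []       = λ ()
  Sat-⋀⁺ (s ∷ ss) = s , Sat-⋀⁺ ss

  Sat-⋀⁻ : ∀ {φs x} → Sat F V x (⋀ φs) → All (Sat F V x) φs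
  Sat-⋀⁻ {[]}    _        = []
  Sat-⋀⁻ {_ ∷ _} (s , ss) = s ∷ Sat-⋀⁻ ss

-- `Jankov` builds its two tables g by local `with`-functions, which cannot be named here.
-- Lemmas about `pairs (suc n) g` leave g unsolved, since its normal form
-- `(g zero zero ++ ⋃suc (g zero)) ++ ⋃suc rows` is blocked on `g zero zero`. Stated for the part
-- `pairsAfterFirst g` after that entry, they recover g by unification from the type of a
-- conjunct of `Jankov`.
module _ {A : Set} {n : ℕ} where

  ⋃suc : (Fin (suc n) → List A) → List A
  ⋃suc h = concat (map h (tabulate suc))

  pairsAfterFirst : (Fin (suc n) → Fin (suc n) → List A) → List A
  pairsAfterFirst g = ⋃suc (g zero) ++ ⋃suc (λ i → concatMap (g i) (allFin (suc n)))

  module _ {P : A → Set} {h : Fin (suc n) → List A} where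

    All-⋃suc⁺ : (∀ t → All P (h (suc t))) → All P (⋃suc h)
    All-⋃suc⁺ f = concat⁺ (map⁺ (tabulate⁺ f))

    All-⋃suc⁻ : All P (⋃suc h) → ∀ t → All P (h (suc t))
    All-⋃suc⁻ a = tabulate⁻ (map⁻ (concat⁻ a))

data NotFirst {n : ℕ} : Fin (suc n) → Fin (suc n) → Set where
  firstRow : ∀ u → NotFirst zero (suc u)
  laterRow : ∀ t j → NotFirst (suc t) j

first-or-notFirst : ∀ {n} (i j : Fin (suc n)) → (i ≡ zero × j ≡ zero) ⊎ NotFirst i j
first-or-notFirst zero    zero    = inj₁ (refl , refl)
first-or-notFirst zero    (suc u) = inj₂ (firstRow u)
first-or-notFirst (suc t) j       = inj₂ (laterRow t j)

module _ {A : Set} {P : A → Set} {n : ℕ} {g : Fin (suc n) → Fin (suc n) → List A} where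

  All-pairsAfterFirst⁺ : (∀ {i j} → NotFirst i j → All P (g i j)) →
                         All P (pairsAfterFirst g)
  All-pairsAfterFirst⁺ f =
    ++⁺ (All-⋃suc⁺ (f ∘ firstRow))
        (All-⋃suc⁺ (λ t → concat⁺ (map⁺ (tabulate⁺ {f = id} (f ∘ laterRow t)))))

  All-pairsAfterFirst⁻ : All P (pairsAfterFirst g) →
                         ∀ {i j} → NotFirst i j → All P (g i j)
  All-pairsAfterFirst⁻ a (firstRow u)   = All-⋃suc⁻ (proj₁ (++⁻ (⋃suc (g zero)) a)) u
  All-pairsAfterFirst⁻ a (laterRow t j) =
    tabulate⁻ {f = id} (map⁻ (concat⁻ (All-⋃suc⁻ (proj₂ (++⁻ _ a)) t))) j

  ¬All-pairsAfterFirst : ExcludedMiddle 0ℓ → ¬ All P (pairsAfterFirst g) →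
                         ∃₂ λ i j → NotFirst i j × ¬ All P (g i j)
  ¬All-pairsAfterFirst em ¬a = em⇒dne em λ none →
    ¬a (All-pairsAfterFirst⁺ λ {i} {j} c → em⇒dne em λ ¬e → none (i , j , c , ¬e))

-- The size n is explicit: unification against the normal form of `pairs` needs it up front.
module _ {F : Frame} {V : Valuation F} {x : Carrier F} (n : ℕ)
         {g : Fin (suc n) → Fin (suc n) → List Fm} where

  Sat-pairsAfterFirst⁻ : Sat F V x (⋀ (pairsAfterFirst g)) →
                         ∀ {i j} → NotFirst i j → All (Sat F V x) (g i j)
  Sat-pairsAfterFirst⁻ s = All-pairsAfterFirst⁻ (Sat-⋀⁻ s)

  ¬Sat-pairsAfterFirst : ExcludedMiddle 0ℓ → ¬ Sat F V x (⋀ (pairsAfterFirst g)) →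
                         ∃₂ λ i j → NotFirst i j × ¬ All (Sat F V x) (g i j)
  ¬Sat-pairsAfterFirst em ¬s = ¬All-pairsAfterFirst em (¬s ∘ Sat-⋀⁺)

p : ∀ {m} → Fin m → Fm
p i = var (toℕ i)

module _ {m : ℕ} (k : ℕ) (i j : Fin m) where

  Exclusive : Fm
  Exclusive = ∇ k (p i ⇒ ¬' (p j))

  Linked : Fm
  Linked = ∇ (k ∸ 1) ((p i ⇒ ◇ (p j)) ∧' (p j ⇒ 𝖯 (p i)))

  Unlinked : Fm
  Unlinked = ∇ (k ∸ 1) ((p i ⇒ ¬' (◇ (p j))) ∧' (p j ⇒ ¬' (𝖯 (p i))))

  RelConjunct : {A : Set} → Dec A → Fm
  RelConjunct (yes _) = Linked
  RelConjunct (no _)  = Unlinked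

-- `Jankov G dec n e k` is `_ ∧' (exclusions ∧' relations)`; on other shapes these are junk.
exclusions : Fm → Fm
exclusions (_ ∧' (φ ∧' _)) = φ
exclusions φ               = φ

relations : Fm → Fm
relations (_ ∧' (_ ∧' φ)) = φ
relations φ               = φ

record JankovConjuncts (F G : Frame) (dec : ∀ a b → Dec (Rel G a b)) (n : ℕ)
                       (e : Fin (suc n) → Carrier G) (k : ℕ)
                       (V : Valuation F) (x : Carrier F) : Set where
  field
    initial   : V 0 x
    covering  : Sat F V x (∇ k (⋁ n p))
    exclusive : ∀ {i j : Fin (suc n)} → i ≢ j → Sat F V x (Exclusive k i j)
    related   : ∀ i j → Sat F V x (RelConjunct k i j (dec (e i) (e j)))

module _ {F G : Frame} {dec : ∀ a b → Dec (Rel G a b)} {n : ℕ} {e : Fin (suc n) → Carrier G}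
         {k : ℕ} {V : Valuation F} {x : Carrier F} where

  private
    J : Fm
    J = Jankov G dec n e k

  exclusive⁻ : Sat F V x (exclusions J) → ∀ {i j} → i ≢ j → Sat F V x (Exclusive k i j)
  exclusive⁻ s {i} {j} i≢j with first-or-notFirst i j
  ... | inj₁ (refl , refl) = contradiction refl i≢j
  ... | inj₂ c with i ≟ j | Sat-pairsAfterFirst⁻ n s c
  ...   | yes i≡j | _       = contradiction i≡j i≢j
  ...   | no _    | s′ ∷ [] = s′

  -- Every relational entry is stuck on `dec`, so the table reduces past its first entry only
  -- once `dec (e zero) (e zero)` is decided.
  related⁻ : Sat F V x (relations J) →
             ∀ i j → Sat F V x (RelConjunct k i j (dec (e i) (e j)))
  related⁻ s i j with first-or-notFirst i j
  related⁻ s _ _ | inj₁ (refl , refl) with dec (e zero) (e zero) | s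
  ... | yes _ | s₀₀ , _ = s₀₀
  ... | no _  | s₀₀ , _ = s₀₀
  related⁻ s i j | inj₂ c with dec (e zero) (e zero) | s
  ... | yes _ | _ , rest with dec (e i) (e j) | Sat-pairsAfterFirst⁻ n rest c
  ...   | yes _ | s′ ∷ [] = s′
  ...   | no _  | s′ ∷ [] = s′
  related⁻ s i j | inj₂ c | no _ | _ , rest with dec (e i) (e j) | Sat-pairsAfterFirst⁻ n rest c
  ...   | yes _ | s′ ∷ [] = s′
  ...   | no _  | s′ ∷ [] = s′

  Sat-Jankov⁻ : Sat F V x J → JankovConjuncts F G dec n e k V x
  Sat-Jankov⁻ ((v₀ , cov) , sE , sR) = record
    { initial = v₀ ; covering = cov ; exclusive = exclusive⁻ sE ; related = related⁻ sR }

  module _ (em : ExcludedMiddle 0ℓ) (c : JankovConjuncts F G dec n e k V x) where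
    open JankovConjuncts c

    ¬¬Sat-exclusions : ¬ ¬ Sat F V x (exclusions J)
    ¬¬Sat-exclusions ¬s with ¬Sat-pairsAfterFirst n em ¬s
    ... | i , j , _ , ¬e with i ≟ j | ¬e
    ...   | yes _  | ¬e′ = ¬e′ []
    ...   | no i≢j | ¬e′ = ¬e′ (exclusive i≢j ∷ [])

    ¬¬Sat-relations : ¬ ¬ Sat F V x (relations J)
    ¬¬Sat-relations ¬s with dec (e zero) (e zero) | related zero zero | ¬s
    ... | yes _ | s₀₀ | ¬s′ with ¬Sat-pairsAfterFirst n em (¬s′ ∘ (s₀₀ ,_))
    ...   | i , j , _ , ¬e with dec (e i) (e j) | related i j | ¬e
    ...     | yes _ | s | ¬e′ = ¬e′ (s ∷ [])
    ...     | no _  | s | ¬e′ = ¬e′ (s ∷ [])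
    ¬¬Sat-relations ¬s | no _ | s₀₀ | ¬s′ with ¬Sat-pairsAfterFirst n em (¬s′ ∘ (s₀₀ ,_))
    ...   | i , j , _ , ¬e with dec (e i) (e j) | related i j | ¬e
    ...     | yes _ | s | ¬e′ = ¬e′ (s ∷ [])
    ...     | no _  | s | ¬e′ = ¬e′ (s ∷ [])

    Sat-Jankov⁺ : Sat F V x J
    Sat-Jankov⁺ =
      (initial , covering) , em⇒dne em ¬¬Sat-exclusions , em⇒dne em ¬¬Sat-relations

module _ (em : ExcludedMiddle 0ℓ) {F G : Frame} (dec : ∀ a b → Dec (Rel G a b)) {n : ℕ}
         {e : Fin (suc n) → Carrier G} {k : ℕ} {y : Carrier G} (G-rooted : Rooted G)
         (F-within : ∀ a b → Reach F k a b) (e-zero : e zero ≡ y)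
         (e-onto : ∀ w → Reach G (suc k) y w → ∃ λ i → e i ≡ w)
         {V : Valuation F} {x : Carrier F} (c : JankovConjuncts F G dec n e (suc k) V x) where
  open JankovConjuncts c

  private
    everywhere : ∀ {φ} → Sat F V x (∇ k φ) → ∀ z → Sat F V z φ
    everywhere s z = em⇒dne em (Sat-∇⁻ k s (F-within x z))

    label : ∀ z → ∃ λ i → V (toℕ i) z
    label z = Sat-⋁⁻ n (everywhere (Sat-∇-pred k covering) z)

    index : Carrier F → Fin (suc n)
    index z = proj₁ (label z)

    labelled : ∀ z → V (toℕ (index z)) z
    labelled z = proj₂ (label z)

    index-unique : ∀ {z i} → V (toℕ i) z → index z ≡ i
    index-unique {z} {i} v with index z ≟ i
    ... | yes eq = eq
    ... | no ne  = ⊥-elim (everywhere (Sat-∇-pred k (exclusive ne)) z (labelled z) v)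

    f : Carrier F → Carrier G
    f z = e (index z)

    f-x : f x ≡ y
    f-x = trans (cong e (index-unique initial)) e-zero

    forth : ∀ {a b} → Rel F a b → Rel G (f a) (f b)
    forth {a} {b} aRb with dec (f a) (f b) | related (index a) (index b)
    ... | yes r | _ = r
    ... | no _  | s =
      ⊥-elim (proj₁ (everywhere s a) (labelled a) (λ □¬ → □¬ b aRb (labelled b)))

    f-reach : ∀ z → Reach G k y (f z)
    f-reach z = subst (λ w → Reach G k w (f z)) f-x (Reach-map f forth k (F-within x z))

    back : ∀ {a w} → Rel G (f a) w → ∃ λ b → Rel F a b × f b ≡ w
    back {a} {w} faRw with e-onto w (inj₂ (inj₁ (f a , f-reach a , faRw)))
    ... | j , refl with dec (f a) (e j) | related (index a) j
    ...   | no ¬r | _ = contradiction faRw ¬r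
    ...   | yes _ | s = em⇒dne em λ none →
      proj₁ (everywhere s a) (labelled a) λ b aRb vb → none (b , aRb , cong e (index-unique vb))

    back⁻¹ : ∀ {a w} → Rel G w (f a) → ∃ λ b → Rel F b a × f b ≡ w
    back⁻¹ {a} {w} wRfa with e-onto w (inj₂ (inj₂ (f a , f-reach a , wRfa)))
    ... | i , refl with dec (e i) (f a) | related i (index a)
    ...   | no ¬r | _ = contradiction wRfa ¬r
    ...   | yes _ | s with proj₂ (everywhere s a) (labelled a)
    ...     | b , bRa , vb = b , bRa , cong e (index-unique vb)

    image-closed : ∀ {a b} → Adjacent G a b → ∃ (λ z → f z ≡ a) → ∃ λ z → f z ≡ b
    image-closed (inj₁ aRb) (_ , refl) = let (z , _ , fz≡b) = back aRb   in z , fz≡b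
    image-closed (inj₂ bRa) (_ , refl) = let (z , _ , fz≡b) = back⁻¹ bRa in z , fz≡b

  surjTMorphism : SurjTMorphismExists F G
  surjTMorphism =
    f , ((λ _ _ → forth) , (λ _ _ → back) , (λ _ _ → forth) , (λ _ _ → back⁻¹)) ,
    Rooted-closed image-closed G-rooted (x , f-x)

module _ {F G : Frame} (dec : ∀ a b → Dec (Rel G a b)) {n : ℕ} {e : Fin (suc n) → Carrier G}
         (e-injective : Injective _≡_ _≡_ e) {k : ℕ} {y : Carrier G} (e-zero : e zero ≡ y)
         (e-onto : ∀ w → Reach G k y w → ∃ λ i → e i ≡ w)
         {f : Carrier F → Carrier G} (f-tmorphism : IsTMorphism F G f)
         {x : Carrier F} (f-x : f x ≡ y) where

  pullback : Valuation F
  pullback m z = ∃ λ i → toℕ i ≡ m × f z ≡ e i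

  private
    forth : ∀ {a b} → Rel F a b → Rel G (f a) (f b)
    forth = proj₁ f-tmorphism _ _

    back : ∀ {a w} → Rel G (f a) w → ∃ λ b → Rel F a b × f b ≡ w
    back = proj₁ (proj₂ f-tmorphism) _ _

    back⁻¹ : ∀ {a w} → Rel G w (f a) → ∃ λ b → Rel F b a × f b ≡ w
    back⁻¹ = proj₂ (proj₂ (proj₂ f-tmorphism)) _ _

    labelled⁺ : ∀ {i z} → f z ≡ e i → pullback (toℕ i) z
    labelled⁺ fz≡ei = _ , refl , fz≡ei

    labelled⁻ : ∀ {i z} → pullback (toℕ i) z → f z ≡ e i
    labelled⁻ (_ , toℕ-eq , fz≡ei′) = trans fz≡ei′ (cong e (toℕ-injective toℕ-eq))

    forth-labels : ∀ {i j a b} → pullback (toℕ i) a → pullback (toℕ j) b →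
                   Rel F a b → Rel G (e i) (e j)
    forth-labels va vb aRb = subst₂ (Rel G) (labelled⁻ va) (labelled⁻ vb) (forth aRb)

    back-labels : ∀ {i j a} → pullback (toℕ i) a → Rel G (e i) (e j) →
                  ∃ λ b → Rel F a b × pullback (toℕ j) b
    back-labels va r with back (subst (λ w → Rel G w _) (sym (labelled⁻ va)) r)
    ... | b , aRb , fb≡ej = b , aRb , labelled⁺ fb≡ej

    back⁻¹-labels : ∀ {i j b} → pullback (toℕ j) b → Rel G (e i) (e j) →
                    ∃ λ a → Rel F a b × pullback (toℕ i) a
    back⁻¹-labels vb r with back⁻¹ (subst (Rel G _) (sym (labelled⁻ vb)) r)
    ... | a , aRb , fa≡ei = a , aRb , labelled⁺ fa≡ei

    f-reach : ∀ {z} → Reach F k x z → Reach G k y (f z)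
    f-reach {z} x⇝z = subst (λ w → Reach G k w (f z)) f-x (Reach-map f forth k x⇝z)

    pullback-related : ∀ i j → Sat F pullback x (RelConjunct k i j (dec (e i) (e j)))
    pullback-related i j with dec (e i) (e j)
    ... | yes r = Sat-∇⁺ (k ∸ 1) λ _ _ →
      (λ vi □¬ → let (b , aRb , vj) = back-labels vi r in □¬ b aRb vj) ,
      (λ vj → back⁻¹-labels vj r)
    ... | no ¬r = Sat-∇⁺ (k ∸ 1) λ _ _ →
      (λ vi ◇vj → ◇vj λ _ aRb vj → ¬r (forth-labels vi vj aRb)) ,
      (λ vj (_ , aRb , vi) → ¬r (forth-labels vi vj aRb))

  pullback-conjuncts : JankovConjuncts F G dec n e k pullback x
  pullback-conjuncts = record
    { initial   = labelled⁺ (trans f-x (sym e-zero))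
    ; covering  = Sat-∇⁺ k λ z x⇝z →
        let (i , ei≡fz) = e-onto (f z) (f-reach x⇝z) in Sat-⋁⁺ n i (labelled⁺ (sym ei≡fz))
    ; exclusive = λ i≢j → Sat-∇⁺ k λ _ _ vi vj →
        i≢j (e-injective (trans (sym (labelled⁻ vi)) (labelled⁻ vj)))
    ; related   = pullback-related
    }

theorem3p12 : ExcludedMiddle 0ℓ →
    (F G : Frame) → Rooted F → Rooted G → ImageFinite G →
    (y : Carrier G) → (k : ℕ) → 1 ≤ k →
    (∀ x z → Reach F (k ∸ 1) x z) →
    (n : ℕ) (e : Fin (suc n) → Carrier G) →
    e zero ≡ y → Injective _≡_ _≡_ e →
    (∀ i → Reach G k y (e i)) →
    (∀ z → Reach G k y z → ∃ (λ i → e i ≡ z)) →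
    (dec : ∀ a b → Dec (Rel G a b)) →
    (SurjTMorphismExists F G ⇔ (¬ Valid F (¬' (Jankov G dec n e k))))
theorem3p12 em F G _ G-rooted _ y (suc k) (s≤s z≤n) F-within n e e-zero e-injective _ e-onto dec =
  -- Not needed: rootedness of F (implied by the k − 1 bound), image-finiteness of G (e is given
  -- outright) and `e i ∈ S_♯^k[y]` (only the covering of S_♯^k[y] by e is used).
  mk⇔ morphism⇒satisfiable satisfiable⇒morphism
  where
    morphism⇒satisfiable : SurjTMorphismExists F G → ¬ Valid F (¬' (Jankov G dec n e (suc k)))
    morphism⇒satisfiable (f , f-tmorphism , f-onto) valid =
      let (x , f-x) = f-onto y
      in valid (pullback dec e-injective e-zero e-onto f-tmorphism f-x) x
           (Sat-Jankov⁺ em (pullback-conjuncts dec e-injective e-zero e-onto f-tmorphism f-x))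

    satisfiable⇒morphism : ¬ Valid F (¬' (Jankov G dec n e (suc k))) → SurjTMorphismExists F G
    satisfiable⇒morphism satisfiable = em⇒dne em λ none → satisfiable λ V x sJ →
      none (surjTMorphism em dec G-rooted F-within e-zero e-onto (Sat-Jankov⁻ sJ))
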